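{- Let $n\ge1$, $\sigma\in\mathrm{NC}(n)$, and let $\{A_1,\dots,A_k\}_<$ and $\{A'_1,\dots,A'_k\}_<$ be the sets of blocks of $\sigma$ and $\rho(\sigma)$ respectively. Then for each $i\in[k]$, $A_i$ is a nonaligned block of $\sigma$ if and only if $A'_i$ is a nonaligned block of $\rho(\sigma)$.
   Context: $[n]=\{1,\dots,n\}$. An edge of a partition of $[n]$ is a pair $(i,j)$, $i<j$, in the same block with no element of that block strictly between. $\mathrm{NC}(n)$ (resp. $\mathrm{NN}(n)$): partitions of $[n]$ with no two edges $(a,b),(c,d)$ with $a<c<b<d$ (resp. $a<c<d<b$). A block $B$ is nonaligned if there is no edge $(i,j)$ with $\max B<i$. $\{A_1,\dots,A_k\}_<$ means $\max A_1<\cdots<\max A_k$. It is known (Athanasiadis) that for $\sigma\in\mathrm{NC}(n)$ with blocks $\{A_1,\dots,A_k\}_<$ there is a unique $\rho(\sigma)\in\mathrm{NN}(n)$ whose blocks $\{A'_1,\dots,A'_k\}_<$ satisfy $\max A'_i=\max A_i$ and $|A'_i|=|A_i|$ for all $i$. -}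

module Defs where

open import Data.Nat using (ℕ)
import Data.Nat as ℕ
open import Data.Fin using (Fin; _<_)
open import Data.List using (length; filter; allFin)
open import Data.Product using (_×_)
open import Relation.Binary.PropositionalEquality using (_≡_; _≢_)
open import Relation.Nullary using (¬_)

-- A set partition of [n] (elements represented by Fin n, i.e. 0..n-1 standing
-- for 1..n, order preserved) given by a block-labelling: i and j lie in the
-- same block iff they carry the same label.
Partition : ℕ → Set
Partition n = Fin n → ℕ

Edge : ∀ {n} → Partition n → Fin n → Fin n → Set
Edge p i j = (i < j) × (p i ≡ p j) × (∀ k → i < k → k < j → p k ≢ p i)

NC : ∀ {n} → Partition n → Set
NC p = ∀ a b c d → Edge p a b → Edge p c d → ¬ ((a < c) × (c < b) × (b < d))

NN : ∀ {n} → Partition n → Set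
NN p = ∀ a b c d → Edge p a b → Edge p c d → ¬ ((a < c) × (c < d) × (d < b))

-- m is the maximum of its block (so blocks correspond bijectively to such m).
IsBlockMax : ∀ {n} → Partition n → Fin n → Set
IsBlockMax p m = ∀ j → m < j → p j ≢ p m

blockSize : ∀ {n} → Partition n → Fin n → ℕ
blockSize {n} p m = length (filter (λ j → p j ℕ.≟ p m) (allFin n))

Nonaligned : ∀ {n} → Partition n → Fin n → Set
Nonaligned p m = ∀ i j → Edge p i j → ¬ (m < i)

module Submission where

-- An element i is the start of some edge
-- exactly when i is not the maximum of its block.  Hence the block with
-- maximum m is nonaligned iff every element after m is the maximum of its
-- block, a condition that only mentions the SET of block maxima.  Since σ and
-- ρ(σ) have the same block maxima, nonalignment of corresponding blocks
-- agrees.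

open import Defs
open import Data.Nat using (ℕ; _≤_)
import Data.Nat as ℕ
open import Data.Fin using (Fin; _<_; _<?_; toℕ)
open import Data.Fin.Properties using (any?)
open import Data.Nat.Induction using (<-wellFounded)
open import Induction.WellFounded using (Acc; acc)
open import Data.Product using (_,_; ∃)
open import Relation.Nullary using (¬_; yes; no)
open import Relation.Nullary.Decidable using (_×-dec_)
open import Relation.Binary.PropositionalEquality using (_≡_; sym)
open import Function.Bundles using (_⇔_; mk⇔; Equivalence)
open import Function.Properties.Equivalence using () renaming (sym to ⇔-sym)

-- If j > i lies in the block of i, then some edge (i , j') starts at i:
-- either nothing of the block lies strictly between i and j, so (i , j) is an
-- edge, or we recurse on such an element k < j (well-founded on j).
edgeFrom : ∀ {n} (p : Partition n) (i j : Fin n) → Acc ℕ._<_ (toℕ j)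
  → i < j → p j ≡ p i → ∃ λ j' → Edge p i j'
edgeFrom p i j (acc smaller) i<j pj≡pi
  with any? (λ k → (i <? k) ×-dec ((k <? j) ×-dec (p k ℕ.≟ p i)))
... | yes (k , i<k , k<j , pk≡pi) = edgeFrom p i k (smaller k<j) i<k pk≡pi
... | no nothingBetween =
  j , i<j , sym pj≡pi , λ k i<k k<j pk≡pi → nothingBetween (k , i<k , k<j , pk≡pi)

blockMax⇔noEdgeFrom : ∀ {n} (p : Partition n) (i : Fin n)
  → IsBlockMax p i ⇔ (∀ j → ¬ Edge p i j)
blockMax⇔noEdgeFrom p i = mk⇔ noEdge isMax
  where
  noEdge : IsBlockMax p i → ∀ j → ¬ Edge p i j
  noEdge iMax j (i<j , pi≡pj , _) = iMax j i<j (sym pi≡pj)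

  isMax : (∀ j → ¬ Edge p i j) → IsBlockMax p i
  isMax none j i<j pj≡pi with edgeFrom p i j (<-wellFounded _) i<j pj≡pi
  ... | j' , edge = none j' edge

nonaligned⇔laterMax : ∀ {n} (p : Partition n) (m : Fin n)
  → Nonaligned p m ⇔ (∀ i → m < i → IsBlockMax p i)
nonaligned⇔laterMax p m = mk⇔ laterMax nonaligned
  where
  laterMax : Nonaligned p m → ∀ i → m < i → IsBlockMax p i
  laterMax na i m<i =
    Equivalence.from (blockMax⇔noEdgeFrom p i) (λ j edge → na i j edge m<i)

  nonaligned : (∀ i → m < i → IsBlockMax p i) → Nonaligned p m
  nonaligned allMax i j edge m<i =
    Equivalence.to (blockMax⇔noEdgeFrom p i) (allMax i m<i) j edge

nonaligned-transfer : ∀ {n} (p q : Partition n)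
  → (∀ m → IsBlockMax p m ⇔ IsBlockMax q m)
  → ∀ m → Nonaligned p m → Nonaligned q m
nonaligned-transfer p q sameMax m na =
  Equivalence.from (nonaligned⇔laterMax q m) λ i m<i →
    Equivalence.to (sameMax i) (Equivalence.to (nonaligned⇔laterMax p m) na i m<i)

lemma5p2 : (n : ℕ) → 1 ≤ n → (σ ρσ : Partition n) → NC σ → NN ρσ
    → (∀ m → IsBlockMax σ m ⇔ IsBlockMax ρσ m)
    → (∀ m → IsBlockMax σ m → blockSize σ m ≡ blockSize ρσ m)
    → ∀ m → IsBlockMax σ m → (Nonaligned σ m ⇔ Nonaligned ρσ m)
lemma5p2 n _ σ ρσ _ _ sameMax _ m _ =
  mk⇔ (nonaligned-transfer σ ρσ sameMax m)
      (nonaligned-transfer ρσ σ (λ k → ⇔-sym (sameMax k)) m)
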